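{- Let $n\ge 1$, $N=2^n$, and let $\pi$ be any permutation of $\{0,1,\dots,N-1\}$. Run the hypercube synthesis procedure described in the context on $\pi$, and let $g_1,g_2,\dots,g_r$ be the multiple-control Toffoli gates it pushes, in the order in which they are pushed. Then the procedure is well defined and terminates, at termination the current table is the identity $(0,1,\dots,N-1)$, i.e. $g_r\circ\cdots\circ g_2\circ g_1\circ\pi=\mathrm{id}$, and consequently $\pi=g_1\circ g_2\circ\cdots\circ g_r$; that is, the returned circuit of multiple-control Toffoli gates realizes $\pi$.
   Context: For $v\in\{0,\dots,N-1\}$ and $j\in\{0,\dots,n-1\}$, write $v_j$ for bit $j$ of the binary expansion of $v$ (bit $0$ least significant) and $v\oplus 2^j$ for $v$ with bit $j$ flipped. A multiple-control Toffoli gate on $n$ lines with target line $j$ and all other $n-1$ lines as controls, each control positive (fires on 1) or negative (fires on 0), flips bit $j$ exactly when the other bits match the control pattern; as a permutation of $\{0,\dots,N-1\}$ it is the transposition $g_{j,v}$ swapping $v$ and $v\oplus 2^j$, where $v$ is either input matching the pattern. A permutation $\pi$ is stored as the table $(\pi[0],\dots,\pi[N-1])$; applying a gate $g$ replaces the table by $g\circ\pi$ (every entry $\pi[k]$ becomes $g(\pi[k])$). Hypercube synthesis procedure: for $i=N-1,N-2,\dots,1$ (in this order), and for each $j=0,1,\dots,n-1$ (least significant bit first), if bit $j$ of the current entry $\pi[i]$ differs from bit $j$ of $i$, let $v$ be the current value of $\pi[i]$, push the gate $g_{j,v}$ onto the output list, and replace the table $\pi$ by $g_{j,v}\circ\pi$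 (so that $\pi[i]$ becomes $v\oplus 2^j$). Output the list of pushed gates. -}

module Defs where

open import Data.Nat using (ℕ; zero; suc; _+_; _∸_; _^_; _/_; _≡ᵇ_)
open import Data.Nat.Base using (_%_)
open import Data.Bool using (Bool; true; false; if_then_else_)
open import Data.Product using (_×_; _,_; proj₁; proj₂)
open import Data.List using (List; []; _∷_; _++_; map; upTo; downFrom; allFin)
open import Data.Fin using (Fin; toℕ)
open import Data.Fin.Permutation using (Permutation′; _⟨$⟩ʳ_)

-- bit j of v (bit 0 least significant)
bit : ℕ → ℕ → Bool
bit v zero    = (v % 2) ≡ᵇ 1
bit v (suc j) = bit (v / 2) j

boolEq : Bool → Bool → Bool
boolEq true  b = b
boolEq false true = false
boolEq false false = true

flipBit : ℕ → ℕ → ℕ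
flipBit v j = if bit v j then v ∸ 2 ^ j else v + 2 ^ j

-- a multiple-control Toffoli gate g_{j,v} is given by the pair (j , v)
Gate : Set
Gate = ℕ × ℕ

gate : Gate → ℕ → ℕ
gate (j , v) x =
  if x ≡ᵇ v then flipBit v j
  else (if x ≡ᵇ flipBit v j then v else x)

-- a table (π[0], …, π[N-1]) is a list; entry lookup by index
Table : Set
Table = List ℕ

at : Table → ℕ → ℕ
at []       _       = 0
at (x ∷ _)  zero    = x
at (_ ∷ xs) (suc i) = at xs i

applyGate : Gate → Table → Table
applyGate g t = map (gate g) t

innerLoop : ℕ → List ℕ → Table → List Gate × Table
innerLoop i []       t = [] , t
innerLoop i (j ∷ js) t with boolEq (bit (at t i) j) (bit i j)
... | true  = innerLoop i js t
... | false =
  let g = (j , at t i)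
      r = innerLoop i js (applyGate g t)
  in g ∷ proj₁ r , proj₂ r

outerLoop : ℕ → List ℕ → Table → List Gate × Table
outerLoop n []       t = [] , t
outerLoop n (i ∷ is) t =
  let r₁ = innerLoop i (upTo n) t
      r₂ = outerLoop n is (proj₂ r₁)
  in proj₁ r₁ ++ proj₁ r₂ , proj₂ r₂

tableOf : ∀ {N} → Permutation′ N → Table
tableOf π = map (λ k → toℕ (π ⟨$⟩ʳ k)) (allFin _)

indicesDown : ℕ → List ℕ
indicesDown N = map suc (downFrom (N ∸ 1))

-- hypercube synthesis: (pushed gates in push order , final table)
synthesis : (n : ℕ) → Permutation′ (2 ^ n) → List Gate × Table
synthesis n π = outerLoop n (indicesDown (2 ^ n)) (tableOf π)

-- g_r ∘ ⋯ ∘ g_1 for the list [g_1, …, g_r]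
applyInOrder : List Gate → ℕ → ℕ
applyInOrder []       x = x
applyInOrder (g ∷ gs) x = applyInOrder gs (gate g x)

-- g_1 ∘ g_2 ∘ ⋯ ∘ g_r for the list [g_1, …, g_r]  (the circuit)
circuit : List Gate → ℕ → ℕ
circuit []       x = x
circuit (g ∷ gs) x = gate g (circuit gs x)

module Submission where

-- Write t for the current table and N = 2^n.  The outer loop maintains the
-- invariant `Solved N i t`: t is the table of a bijection of [0,N) which is
-- the identity at every position above i.  While position i is processed,
-- the entry v = t[i] satisfies v ≤ i (v is not any of the fixed points k > i,
-- by injectivity) and agrees with i on the bits already treated.  When bit j
-- of v is wrong, v ⊕ 2^j ≤ i as well: clearing a bit decreases v, and setting
-- bit j (clear in v, set in i) keeps v ≤ i because v and i agree below j.
-- So the gate swaps two values ≤ i, and the fixed points above i survive.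
-- After all n bits, t[i] = i since numbers below 2^n are determined by their
-- n low bits; after i = 1 the entry t[0] is forced to be 0, and the table is
-- the identity.  Independently, the final table is the initial one composed
-- with the pushed gates in push order; since gates are involutions, the
-- circuit applying them in reverse order inverts that composition, which
-- gives the factorisation of π.

open import Defs
open import Data.Nat
open import Data.Nat.Properties
open import Data.Nat.DivMod
open import Data.Nat.Tactic.RingSolver using (solve-∀)
open import Data.Bool using (true; false; not; T)
open import Data.Product using (_×_; _,_; proj₁; proj₂)
open import Data.Sum using (_⊎_; inj₁; inj₂)
open import Data.Empty using (⊥-elim)
open import Relation.Nullary using (yes; no)
open import Relation.Binary.PropositionalEquality
open import Data.List using (List; []; _∷_; _++_; map; length; applyUpTo; upTo; downFrom; tabulate)
open import Data.List.Properties using (length-map; map-∘; map-cong; length-applyUpTo; length-tabulate)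
open import Data.Fin using (Fin; toℕ; fromℕ<)
open import Data.Fin.Properties using (toℕ-injective; toℕ-fromℕ<; toℕ<n)
open import Data.Fin.Permutation using (Permutation′; _⟨$⟩ʳ_; _⟨$⟩ˡ_; inverseˡ)
open import Function using (_∘_; id)

even-or-odd : ∀ v → v % 2 ≡ 0 ⊎ v % 2 ≡ 1
even-or-odd v with v % 2 | m%n<n v 2
... | 0           | _               = inj₁ refl
... | 1           | _               = inj₂ refl
... | suc (suc _) | s≤s (s≤s ())

bit0-even : ∀ {v} → v % 2 ≡ 0 → bit v 0 ≡ false
bit0-even even = cong (_≡ᵇ 1) even

bit0-odd : ∀ {v} → v % 2 ≡ 1 → bit v 0 ≡ true
bit0-odd odd = cong (_≡ᵇ 1) odd

bit0⇒sameParity : ∀ v i → bit v 0 ≡ bit i 0 → v % 2 ≡ i % 2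
bit0⇒sameParity v i same with even-or-odd v | even-or-odd i
... | inj₁ a | inj₁ b = trans a (sym b)
... | inj₂ a | inj₂ b = trans a (sym b)
... | inj₁ a | inj₂ b with () ← trans (sym (bit0-even {v} a)) (trans same (bit0-odd {i} b))
... | inj₂ a | inj₁ b with () ← trans (sym (bit0-odd {v} a)) (trans same (bit0-even {i} b))

divMod2-unique : ∀ {x} r q → r < 2 → x ≡ r + q * 2 → x % 2 ≡ r × x / 2 ≡ q
divMod2-unique 0 q _ refl = m*n%n≡0 q 2 , m*n/n≡m q 2
divMod2-unique 1 q _ refl = [m+kn]%n≡m%n 1 q 2 , (begin
    (1 + q * 2) / 2       ≡⟨ +-distrib-/ 1 (q * 2) (subst (λ z → 1 + z < 2) (sym (m*n%n≡0 q 2)) ≤-refl) ⟩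
    1 / 2 + q * 2 / 2     ≡⟨ cong (0 +_) (m*n/n≡m q 2) ⟩
    q                     ∎)
  where open ≡-Reasoning
divMod2-unique (suc (suc _)) q (s≤s (s≤s ())) _

bit⇒2^j≤ : ∀ v j → bit v j ≡ true → 2 ^ j ≤ v
bit⇒2^j≤ zero    zero ()
bit⇒2^j≤ (suc v) zero _ = s≤s z≤n
bit⇒2^j≤ v (suc j) set = begin
    2 * 2 ^ j   ≡⟨ *-comm 2 (2 ^ j) ⟩
    2 ^ j * 2   ≤⟨ *-monoˡ-≤ 2 (bit⇒2^j≤ (v / 2) j set) ⟩
    v / 2 * 2   ≤⟨ m/n*n≤m v 2 ⟩
    v           ∎
  where open ≤-Reasoning

flipBit-zero≡ : ∀ v → flipBit v 0 ≡ (1 ∸ v % 2) + v / 2 * 2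
flipBit-zero≡ v with even-or-odd v
... | inj₁ even rewrite bit0-even {v} even = begin
    v + 1                     ≡⟨ +-comm v 1 ⟩
    1 + v                     ≡⟨ cong (1 +_) (m≡m%n+[m/n]*n v 2) ⟩
    1 + (v % 2 + v / 2 * 2)   ≡⟨ cong (λ r → 1 + (r + v / 2 * 2)) even ⟩
    1 + v / 2 * 2             ≡⟨ cong (λ r → 1 ∸ r + v / 2 * 2) (sym even) ⟩
    1 ∸ v % 2 + v / 2 * 2     ∎
  where open ≡-Reasoning
... | inj₂ odd rewrite bit0-odd {v} odd = begin
    v ∸ 1                     ≡⟨ cong (_∸ 1) (m≡m%n+[m/n]*n v 2) ⟩
    v % 2 + v / 2 * 2 ∸ 1     ≡⟨ cong (λ r → r + v / 2 * 2 ∸ 1) odd ⟩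
    v / 2 * 2                 ≡⟨ cong (λ r → 1 ∸ r + v / 2 * 2) (sym odd) ⟩
    1 ∸ v % 2 + v / 2 * 2     ∎
  where open ≡-Reasoning

flipBit-suc≡ : ∀ v j → flipBit v (suc j) ≡ v % 2 + flipBit (v / 2) j * 2
flipBit-suc≡ v j with bit (v / 2) j in set
... | false = begin
    v + 2 * 2 ^ j                   ≡⟨ cong (_+ 2 * 2 ^ j) (m≡m%n+[m/n]*n v 2) ⟩
    v % 2 + v / 2 * 2 + 2 * 2 ^ j   ≡⟨ regroup (v % 2) (v / 2) (2 ^ j) ⟩
    v % 2 + (v / 2 + 2 ^ j) * 2     ∎
  where
  open ≡-Reasoning
  regroup : ∀ r q p → r + q * 2 + 2 * p ≡ r + (q + p) * 2
  regroup = solve-∀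
... | true = begin
    v ∸ 2 * 2 ^ j                             ≡⟨ cong (_∸ 2 * 2 ^ j) (m≡m%n+[m/n]*n v 2) ⟩
    v % 2 + v / 2 * 2 ∸ 2 * 2 ^ j             ≡⟨ cong (λ q → v % 2 + q * 2 ∸ 2 * 2 ^ j) half≡ ⟩
    v % 2 + (2 ^ j + d) * 2 ∸ 2 * 2 ^ j       ≡⟨ cong (_∸ 2 * 2 ^ j) (regroup (v % 2) (2 ^ j) d) ⟩
    2 * 2 ^ j + (v % 2 + d * 2) ∸ 2 * 2 ^ j   ≡⟨ m+n∸m≡n (2 * 2 ^ j) _ ⟩
    v % 2 + d * 2                             ∎
  where
  open ≡-Reasoning
  d : ℕ
  d = v / 2 ∸ 2 ^ j
  half≡ : v / 2 ≡ 2 ^ j + d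
  half≡ = sym (m+[n∸m]≡n (bit⇒2^j≤ (v / 2) j set))
  regroup : ∀ r p d → r + (p + d) * 2 ≡ 2 * p + (r + d * 2)
  regroup = solve-∀

flipBit-zero-digits : ∀ v → flipBit v 0 % 2 ≡ 1 ∸ v % 2 × flipBit v 0 / 2 ≡ v / 2
flipBit-zero-digits v = divMod2-unique (1 ∸ v % 2) (v / 2) (s≤s (m∸n≤m 1 (v % 2))) (flipBit-zero≡ v)

flipBit-suc-digits : ∀ v j → flipBit v (suc j) % 2 ≡ v % 2 × flipBit v (suc j) / 2 ≡ flipBit (v / 2) j
flipBit-suc-digits v j = divMod2-unique (v % 2) (flipBit (v / 2) j) (m%n<n v 2) (flipBit-suc≡ v j)

bit-flipBit-same : ∀ j v → bit (flipBit v j) j ≡ not (bit v j)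
bit-flipBit-same zero v with even-or-odd v | flipBit-zero-digits v
... | inj₁ even | parity′ , _ =
  trans (cong (_≡ᵇ 1) (trans parity′ (cong (1 ∸_) even))) (cong not (sym (bit0-even {v} even)))
... | inj₂ odd  | parity′ , _ =
  trans (cong (_≡ᵇ 1) (trans parity′ (cong (1 ∸_) odd))) (cong not (sym (bit0-odd {v} odd)))
bit-flipBit-same (suc j) v =
  trans (cong (λ w → bit w j) (proj₂ (flipBit-suc-digits v j)))
        (bit-flipBit-same j (v / 2))

bit-flipBit-other : ∀ j k v → k ≢ j → bit (flipBit v j) k ≡ bit v k
bit-flipBit-other zero zero v k≢j = ⊥-elim (k≢j refl)
bit-flipBit-other zero (suc k) v _ =
  cong (λ w → bit w k) (proj₂ (flipBit-zero-digits v))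
bit-flipBit-other (suc j) zero v _ =
  cong (_≡ᵇ 1) (proj₁ (flipBit-suc-digits v j))
bit-flipBit-other (suc j) (suc k) v k≢j =
  trans (cong (λ w → bit w k) (proj₂ (flipBit-suc-digits v j)))
        (bit-flipBit-other j k (v / 2) (k≢j ∘ cong suc))

flipBit≢ : ∀ v j → flipBit v j ≢ v
flipBit≢ v j with bit v j in set
... | true  = <⇒≢ (∸-monoʳ-< {o = 0} (m^n>0 2 j) (bit⇒2^j≤ v j set))
... | false = ≢-sym (<⇒≢ (m<m+n v (m^n>0 2 j)))

bits-injective : ∀ n v i → v < 2 ^ n → i < 2 ^ n → (∀ k → k < n → bit v k ≡ bit i k) → v ≡ i
bits-injective zero zero    zero    _ _ _ = refl
bits-injective zero (suc v) i       (s≤s ()) _ _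
bits-injective zero zero    (suc i) _ (s≤s ()) _
bits-injective (suc n) v i v< i< same = begin
    v                   ≡⟨ m≡m%n+[m/n]*n v 2 ⟩
    v % 2 + v / 2 * 2   ≡⟨ cong₂ (λ r q → r + q * 2) (bit0⇒sameParity v i (same 0 (s≤s z≤n))) halves ⟩
    i % 2 + i / 2 * 2   ≡⟨ m≡m%n+[m/n]*n i 2 ⟨
    i                   ∎
  where
  open ≡-Reasoning
  half< : ∀ x → x < 2 * 2 ^ n → x / 2 < 2 ^ n
  half< x x< = m<n*o⇒m/o<n (subst (x <_) (*-comm 2 (2 ^ n)) x<)
  halves : v / 2 ≡ i / 2
  halves = bits-injective n (v / 2) (i / 2) (half< v v<) (half< i i<) (λ k k< → same (suc k) (s≤s k<))

setBit≤ : ∀ j v i → v ≤ i → (∀ k → k < j → bit v k ≡ bit i k) →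
          bit v j ≡ false → bit i j ≡ true → v + 2 ^ j ≤ i
setBit≤ zero v i v≤i _ clear set with m≤n⇒m<n∨m≡n v≤i
... | inj₁ v<i  = subst (_≤ i) (+-comm 1 v) v<i
... | inj₂ refl with () ← trans (sym clear) set
setBit≤ (suc j) v i v≤i same clear set = begin
    v + 2 * 2 ^ j                   ≡⟨ cong (_+ 2 * 2 ^ j) (m≡m%n+[m/n]*n v 2) ⟩
    v % 2 + v / 2 * 2 + 2 * 2 ^ j   ≡⟨ regroup (v % 2) (v / 2) (2 ^ j) ⟩
    v % 2 + (v / 2 + 2 ^ j) * 2     ≤⟨ +-mono-≤ (≤-reflexive (bit0⇒sameParity v i (same 0 (s≤s z≤n))))
                                                (*-monoˡ-≤ 2 halves≤) ⟩
    i % 2 + i / 2 * 2               ≡⟨ m≡m%n+[m/n]*n i 2 ⟨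
    i                               ∎
  where
  open ≤-Reasoning
  regroup : ∀ r q p → r + q * 2 + 2 * p ≡ r + (q + p) * 2
  regroup = solve-∀
  halves≤ : v / 2 + 2 ^ j ≤ i / 2
  halves≤ = setBit≤ j (v / 2) (i / 2) (/-monoˡ-≤ 2 v≤i) (λ k k< → same (suc k) (s≤s k<)) clear set


≡ᵇ-refl : ∀ x → (x ≡ᵇ x) ≡ true
≡ᵇ-refl zero    = refl
≡ᵇ-refl (suc x) = ≡ᵇ-refl x

≡ᵇ-≢ : ∀ {x y} → x ≢ y → (x ≡ᵇ y) ≡ false
≡ᵇ-≢ {x} {y} x≢y with x ≡ᵇ y in test
... | false = refl
... | true  = ⊥-elim (x≢y (≡ᵇ⇒≡ x y (subst T (sym test) _)))

gate-at-v : ∀ j v → gate (j , v) v ≡ flipBit v j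
gate-at-v j v rewrite ≡ᵇ-refl v = refl

gate-at-flip : ∀ j v → gate (j , v) (flipBit v j) ≡ v
gate-at-flip j v rewrite ≡ᵇ-≢ (flipBit≢ v j) | ≡ᵇ-refl (flipBit v j) = refl

gate-elsewhere : ∀ j v x → x ≢ v → x ≢ flipBit v j → gate (j , v) x ≡ x
gate-elsewhere j v x x≢v x≢w rewrite ≡ᵇ-≢ x≢v | ≡ᵇ-≢ x≢w = refl

gate-involutive : ∀ g x → gate g (gate g x) ≡ x
gate-involutive (j , v) x with x ≟ v
... | yes refl = trans (cong (gate (j , v)) (gate-at-v j v)) (gate-at-flip j v)
... | no x≢v with x ≟ flipBit v j
...   | yes refl = trans (cong (gate (j , v)) (gate-at-flip j v)) (gate-at-v j v)
...   | no x≢w   = trans (cong (gate (j , v)) (gate-elsewhere j v x x≢v x≢w)) (gate-elsewhere j v x x≢v x≢w)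

gate-below : ∀ j v i x → v ≤ i → flipBit v j ≤ i → x ≤ i → gate (j , v) x ≤ i
gate-below j v i x v≤ w≤ x≤ with x ≟ v
... | yes refl = subst (_≤ i) (sym (gate-at-v j v)) w≤
... | no x≢v with x ≟ flipBit v j
...   | yes refl = subst (_≤ i) (sym (gate-at-flip j v)) v≤
...   | no x≢w   = subst (_≤ i) (sym (gate-elsewhere j v x x≢v x≢w)) x≤

gate-above : ∀ j v i x → v ≤ i → flipBit v j ≤ i → i < x → gate (j , v) x ≡ x
gate-above j v i x v≤ w≤ i<x =
  gate-elsewhere j v x (λ { refl → <⇒≱ i<x v≤ }) (λ { refl → <⇒≱ i<x w≤ })


at-map : ∀ f t k → k < length t → at (map f t) k ≡ f (at t k)
at-map f (x ∷ t) zero    _         = refl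
at-map f (x ∷ t) (suc k) (s≤s k<) = at-map f t k k<

at-applyUpTo : ∀ f m k → k < m → at (applyUpTo f m) k ≡ f k
at-applyUpTo f (suc m) zero    _         = refl
at-applyUpTo f (suc m) (suc k) (s≤s k<) = at-applyUpTo (f ∘ suc) m k k<

table-ext : ∀ xs ys → length xs ≡ length ys → (∀ k → k < length xs → at xs k ≡ at ys k) → xs ≡ ys
table-ext []       []       _ _    = refl
table-ext (x ∷ xs) (y ∷ ys) e same =
  cong₂ _∷_ (same 0 (s≤s z≤n)) (table-ext xs ys (suc-injective e) (λ k k< → same (suc k) (s≤s k<)))

at-tabulate : ∀ {A : Set} {N} (h : A → ℕ) (g : Fin N → A) (k : Fin N) → at (map h (tabulate g)) (toℕ k) ≡ h (g k)
at-tabulate {N = suc N} h g Fin.zero    = refl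
at-tabulate {N = suc N} h g (Fin.suc k) = at-tabulate h (g ∘ Fin.suc) k

at-tableOf : ∀ {N} (π : Permutation′ N) (k : Fin N) → at (tableOf π) (toℕ k) ≡ toℕ (π ⟨$⟩ʳ k)
at-tableOf π = at-tabulate _ id

length-tableOf : ∀ {N} (π : Permutation′ N) → length (tableOf π) ≡ N
length-tableOf π = trans (length-map (λ k → toℕ (π ⟨$⟩ʳ k)) (tabulate id)) (length-tabulate id)


record Solved (N i : ℕ) (t : Table) : Set where
  field
    length≡    : length t ≡ N
    bounded    : ∀ k → k < N → at t k < N
    injective  : ∀ k l → k < N → l < N → at t k ≡ at t l → k ≡ l
    fixedAbove : ∀ k → i < k → k < N → at t k ≡ k
open Solved

tableOf-solved : ∀ N (π : Permutation′ N) → Solved N (N ∸ 1) (tableOf π)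
tableOf-solved N π = record
  { length≡    = length-tableOf π
  ; bounded    = λ k k< → subst (_< N) (sym (at-π k k<)) (toℕ<n _)
  ; injective  = injective′
  ; fixedAbove = λ k N-1<k k< → ⊥-elim (<⇒≱ N-1<k (∸-monoˡ-≤ 1 k<))
  }
  where
  at-π : ∀ k (k< : k < N) → at (tableOf π) k ≡ toℕ (π ⟨$⟩ʳ fromℕ< k<)
  at-π k k< = subst (λ z → at (tableOf π) z ≡ toℕ (π ⟨$⟩ʳ fromℕ< k<)) (toℕ-fromℕ< k<) (at-tableOf π (fromℕ< k<))
  injective′ : ∀ k l → k < N → l < N → at (tableOf π) k ≡ at (tableOf π) l → k ≡ l
  injective′ k l k< l< e = begin
      k                             ≡⟨ toℕ-fromℕ< k< ⟨
      toℕ (fromℕ< k<)               ≡⟨ cong toℕ (inverseˡ π) ⟨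
      toℕ (π ⟨$⟩ˡ (π ⟨$⟩ʳ fromℕ< k<)) ≡⟨ cong (toℕ ∘ (π ⟨$⟩ˡ_)) π-equal ⟩
      toℕ (π ⟨$⟩ˡ (π ⟨$⟩ʳ fromℕ< l<)) ≡⟨ cong toℕ (inverseˡ π) ⟩
      toℕ (fromℕ< l<)               ≡⟨ toℕ-fromℕ< l< ⟩
      l                             ∎
    where
    open ≡-Reasoning
    π-equal : π ⟨$⟩ʳ fromℕ< k< ≡ π ⟨$⟩ʳ fromℕ< l<
    π-equal = toℕ-injective (trans (sym (at-π k k<)) (trans e (at-π l l<)))

-- The entry at position i is at most i: a larger value k is already taken
-- by position k.
entry≤index : ∀ {N i t} → Solved N i t → i < N → at t i ≤ i
entry≤index {N} {i} {t} S i<N with at t i ≤? i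
... | yes ≤i = ≤i
... | no  ≰i = ⊥-elim (<⇒≢ i<v (injective S i v i<N (bounded S i i<N) (sym (fixedAbove S v i<v (bounded S i i<N)))))
  where
  v : ℕ
  v = at t i
  i<v : i < v
  i<v = ≰⇒> ≰i

gate-preserves : ∀ {N i t} j v → i < N → v ≤ i → flipBit v j ≤ i → Solved N i t → Solved N i (applyGate (j , v) t)
gate-preserves {N} {i} {t} j v i<N v≤ w≤ S = record
  { length≡    = trans (length-map g t) (length≡ S)
  ; bounded    = bounded′
  ; injective  = λ k l k< l< e → injective S k l k< l< (gate-injective (trans (sym (at′ k k<)) (trans e (at′ l l<))))
  ; fixedAbove = λ k i<k k< → trans (at′ k k<)
                   (trans (cong g (fixedAbove S k i<k k<)) (gate-above j v i k v≤ w≤ i<k))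
  }
  where
  g : ℕ → ℕ
  g = gate (j , v)
  at′ : ∀ k → k < N → at (map g t) k ≡ g (at t k)
  at′ k k< = at-map g t k (subst (k <_) (sym (length≡ S)) k<)
  gate-injective : ∀ {x y} → g x ≡ g y → x ≡ y
  gate-injective {x} {y} e = trans (sym (gate-involutive (j , v) x)) (trans (cong g e) (gate-involutive (j , v) y))
  bounded′ : ∀ k → k < N → at (map g t) k < N
  bounded′ k k< with at t k ≤? i
  ... | yes ≤i = subst (_< N) (sym (at′ k k<)) (≤-<-trans (gate-below j v i (at t k) v≤ w≤ ≤i) i<N)
  ... | no  ≰i = subst (_< N) (sym (trans (at′ k k<) (gate-above j v i (at t k) v≤ w≤ (≰⇒> ≰i)))) (bounded S k k<)

Solved-step : ∀ {N i t} → Solved N (suc i) t → at t (suc i) ≡ suc i → Solved N i t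
Solved-step {N} {i} {t} S fixed = record
  { length≡ = length≡ S ; bounded = bounded S ; injective = injective S ; fixedAbove = fixedAbove′ }
  where
  fixedAbove′ : ∀ k → i < k → k < N → at t k ≡ k
  fixedAbove′ k i<k k< with m≤n⇒m<n∨m≡n i<k
  ... | inj₁ si<k = fixedAbove S k si<k k<
  ... | inj₂ refl = fixed

Solved-identity : ∀ {N t} → 0 < N → Solved N 0 t → t ≡ upTo N
Solved-identity {N} {t} 0<N S =
  table-ext t (upTo N) (trans (length≡ S) (sym (length-applyUpTo id N))) entries
  where
  entries : ∀ k → k < length t → at t k ≡ at (upTo N) k
  entries zero    _  = trans (n≤0⇒n≡0 (entry≤index S 0<N)) (sym (at-applyUpTo id N 0 0<N))
  entries (suc k) k< = let k<N = subst (suc k <_) (length≡ S) k< in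
    trans (fixedAbove S (suc k) (s≤s z≤n) k<N) (sym (at-applyUpTo id N (suc k) k<N))


boolEq-true : ∀ a b → boolEq a b ≡ true → a ≡ b
boolEq-true true  true  _ = refl
boolEq-true false false _ = refl
boolEq-true true  false ()
boolEq-true false true  ()

boolEq-false : ∀ a b → boolEq a b ≡ false → not a ≡ b
boolEq-false true  false _ = refl
boolEq-false false true  _ = refl
boolEq-false true  true  ()
boolEq-false false false ()

record Correcting (N i j : ℕ) (t : Table) : Set where
  field
    solved  : Solved N i t
    entry≤  : at t i ≤ i
    lowBits : ∀ k → k < j → bit (at t i) k ≡ bit i k
open Correcting

extend-lowBits : ∀ {v i j} → (∀ k → k < j → bit v k ≡ bit i k) → bit v j ≡ bit i j →
                 ∀ k → k < suc j → bit v k ≡ bit i k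
extend-lowBits low same k k<sj with m≤n⇒m<n∨m≡n (s≤s⁻¹ k<sj)
... | inj₁ k<j  = low k k<j
... | inj₂ refl = same

correct-keep : ∀ {N i j t} → boolEq (bit (at t i) j) (bit i j) ≡ true → Correcting N i j t → Correcting N i (suc j) t
correct-keep agree C = record
  { solved = solved C ; entry≤ = entry≤ C ; lowBits = extend-lowBits (lowBits C) (boolEq-true _ _ agree) }

flipBit≤ : ∀ j v i → v ≤ i → (∀ k → k < j → bit v k ≡ bit i k) → boolEq (bit v j) (bit i j) ≡ false → flipBit v j ≤ i
flipBit≤ j v i v≤i low differ with bit v j in bv
... | true  = ≤-trans (m∸n≤m v (2 ^ j)) v≤i
... | false = setBit≤ j v i v≤i low bv (sym (boolEq-false false (bit i j) differ))

correct-flip : ∀ {N i j t} → i < N → boolEq (bit (at t i) j) (bit i j) ≡ false →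
               Correcting N i j t → Correcting N i (suc j) (applyGate (j , at t i) t)
correct-flip {N} {i} {j} {t} i<N differ C = record
  { solved  = gate-preserves j v i<N (entry≤ C) w≤ (solved C)
  ; entry≤  = subst (_≤ i) (sym entry′) w≤
  ; lowBits = subst (λ w → ∀ k → k < suc j → bit w k ≡ bit i k) (sym entry′) (extend-lowBits low′ bit-j)
  }
  where
  v : ℕ
  v = at t i
  w≤ : flipBit v j ≤ i
  w≤ = flipBit≤ j v i (entry≤ C) (lowBits C) differ
  entry′ : at (applyGate (j , v) t) i ≡ flipBit v j
  entry′ = trans (at-map (gate (j , v)) t i (subst (i <_) (sym (length≡ (solved C))) i<N)) (gate-at-v j v)
  low′ : ∀ k → k < j → bit (flipBit v j) k ≡ bit i k
  low′ k k<j = trans (bit-flipBit-other j k v (<⇒≢ k<j)) (lowBits C k k<j)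
  bit-j : bit (flipBit v j) j ≡ bit i j
  bit-j = trans (bit-flipBit-same j v) (boolEq-false _ _ differ)

innerLoop-correct : ∀ {N i} n m (f : ℕ → ℕ) j t → i < N → (∀ x → f x ≡ j + x) → j + m ≡ n →
                    Correcting N i j t → Correcting N i n (proj₂ (innerLoop i (applyUpTo f m) t))
innerLoop-correct n zero f j t i<N f≡ j+0≡n C = subst (λ j → Correcting _ _ j t) (trans (sym (+-identityʳ j)) j+0≡n) C
innerLoop-correct {i = i} n (suc m) f j t i<N f≡ j+m≡n C
  with f 0 | f≡ 0 | boolEq (bit (at t i) (f 0)) (bit i (f 0)) in test
... | _ | f0≡ | true  rewrite trans f0≡ (+-identityʳ j) =
  innerLoop-correct n m (f ∘ suc) (suc j) t i<N (λ x → trans (f≡ (suc x)) (+-suc j x))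
    (trans (sym (+-suc j m)) j+m≡n) (correct-keep test C)
... | _ | f0≡ | false rewrite trans f0≡ (+-identityʳ j) =
  innerLoop-correct n m (f ∘ suc) (suc j) _ i<N (λ x → trans (f≡ (suc x)) (+-suc j x))
    (trans (sym (+-suc j m)) j+m≡n) (correct-flip i<N test C)

innerLoop-fixes : ∀ n {i t} → i < 2 ^ n → Solved (2 ^ n) i t →
                  Solved (2 ^ n) i (proj₂ (innerLoop i (upTo n) t)) × at (proj₂ (innerLoop i (upTo n) t)) i ≡ i
innerLoop-fixes n {i} {t} i<N S = solved C , bits-injective n _ i (≤-<-trans (entry≤ C) i<N) i<N (lowBits C)
  where
  C : Correcting (2 ^ n) i n (proj₂ (innerLoop i (upTo n) t))
  C = innerLoop-correct n n id 0 t i<N (λ _ → refl) refl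
        (record { solved = S ; entry≤ = entry≤index S i<N ; lowBits = λ k () })


outerLoop-correct : ∀ n m t → m < 2 ^ n → Solved (2 ^ n) m t →
                    Solved (2 ^ n) 0 (proj₂ (outerLoop n (map suc (downFrom m)) t))
outerLoop-correct n zero    t _    S = S
outerLoop-correct n (suc m) t m<N S =
  outerLoop-correct n m _ (<-trans (n<1+n m) m<N) (Solved-step (proj₁ fixed) (proj₂ fixed))
  where
  fixed : Solved (2 ^ n) (suc m) (proj₂ (innerLoop (suc m) (upTo n) t))
          × at (proj₂ (innerLoop (suc m) (upTo n) t)) (suc m) ≡ suc m
  fixed = innerLoop-fixes n m<N S


applyInOrder-++ : ∀ gs hs x → applyInOrder (gs ++ hs) x ≡ applyInOrder hs (applyInOrder gs x)
applyInOrder-++ []       hs x = refl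
applyInOrder-++ (g ∷ gs) hs x = applyInOrder-++ gs hs (gate g x)

map-applyInOrder-[] : ∀ t → map (applyInOrder []) t ≡ t
map-applyInOrder-[] []      = refl
map-applyInOrder-[] (x ∷ t) = cong (x ∷_) (map-applyInOrder-[] t)

innerLoop-trace : ∀ i js t → proj₂ (innerLoop i js t) ≡ map (applyInOrder (proj₁ (innerLoop i js t))) t
innerLoop-trace i []       t = sym (map-applyInOrder-[] t)
innerLoop-trace i (j ∷ js) t with boolEq (bit (at t i) j) (bit i j)
... | true  = innerLoop-trace i js t
... | false = trans (innerLoop-trace i js (applyGate (j , at t i) t)) (sym (map-∘ t))

outerLoop-trace : ∀ n is t → proj₂ (outerLoop n is t) ≡ map (applyInOrder (proj₁ (outerLoop n is t))) t
outerLoop-trace n []       t = sym (map-applyInOrder-[] t)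
outerLoop-trace n (i ∷ is) t = begin
    proj₂ (outerLoop n is t₁)                         ≡⟨ outerLoop-trace n is t₁ ⟩
    map (applyInOrder hs) t₁                          ≡⟨ cong (map (applyInOrder hs)) (innerLoop-trace i (upTo n) t) ⟩
    map (applyInOrder hs) (map (applyInOrder gs) t)   ≡⟨ map-∘ t ⟨
    map (applyInOrder hs ∘ applyInOrder gs) t         ≡⟨ map-cong (λ x → sym (applyInOrder-++ gs hs x)) t ⟩
    map (applyInOrder (gs ++ hs)) t                   ∎
  where
  open ≡-Reasoning
  t₁ : Table
  t₁ = proj₂ (innerLoop i (upTo n) t)
  gs hs : List Gate
  gs = proj₁ (innerLoop i (upTo n) t)
  hs = proj₁ (outerLoop n is t₁)

-- Since gates are involutions, the circuit g₁ ∘ ⋯ ∘ g_r undoes g_r ∘ ⋯ ∘ g₁.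
circuit-inverts : ∀ gs x → circuit gs (applyInOrder gs x) ≡ x
circuit-inverts []       x = refl
circuit-inverts (g ∷ gs) x = trans (cong (gate g) (circuit-inverts gs (gate g x))) (gate-involutive g x)


-- The synthesis ends at the identity table (by the invariant), that table is
-- π composed with the pushed gates (by the trace), and inverting the gates
-- shows that the circuit realizes π.
mainTheorem1 : (n : ℕ) → 1 ≤ n → (π : Permutation′ (2 ^ n)) →
    (proj₂ (synthesis n π) ≡ upTo (2 ^ n))
    × (map (applyInOrder (proj₁ (synthesis n π))) (tableOf π) ≡ upTo (2 ^ n))
    × ((k : Fin (2 ^ n)) → toℕ (π ⟨$⟩ʳ k) ≡ circuit (proj₁ (synthesis n π)) (toℕ k))
mainTheorem1 n _ π = identity , composed , realizes
  where
  N : ℕ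
  N = 2 ^ n
  gs : List Gate
  gs = proj₁ (synthesis n π)
  0<N : 0 < N
  0<N = m^n>0 2 n
  identity : proj₂ (synthesis n π) ≡ upTo N
  identity = Solved-identity 0<N
    (outerLoop-correct n (N ∸ 1) (tableOf π) (∸-monoʳ-< {o = 0} (s≤s z≤n) 0<N) (tableOf-solved N π))
  composed : map (applyInOrder gs) (tableOf π) ≡ upTo N
  composed = trans (sym (outerLoop-trace n (indicesDown N) (tableOf π))) identity
  realizes : (k : Fin N) → toℕ (π ⟨$⟩ʳ k) ≡ circuit gs (toℕ k)
  realizes k = trans (sym (circuit-inverts gs _)) (cong (circuit gs) (begin
      applyInOrder gs (toℕ (π ⟨$⟩ʳ k))                ≡⟨ cong (applyInOrder gs) (at-tableOf π k) ⟨
      applyInOrder gs (at (tableOf π) (toℕ k))        ≡⟨ at-map (applyInOrder gs) (tableOf π) (toℕ k) k<length ⟨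
      at (map (applyInOrder gs) (tableOf π)) (toℕ k)  ≡⟨ cong (λ t → at t (toℕ k)) composed ⟩
      at (upTo N) (toℕ k)                             ≡⟨ at-applyUpTo id N (toℕ k) (toℕ<n k) ⟩
      toℕ k                                           ∎))
    where
    open ≡-Reasoning
    k<length : toℕ k < length (tableOf π)
    k<length = subst (toℕ k <_) (sym (length-tableOf π)) (toℕ<n k)
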